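{- Let $p$ be a propositional variable. There is no formula $\phi\in\mathcal{L}_\Box$ that defines $\blacktriangle p$ on the class of all frames; likewise none on the class of all reflexive frames, of all transitive frames, of all symmetric frames, or of all Euclidean frames.
   Context: Formulas are built from a countable set $\mathsf{Var}$ of variables; $\mathcal{L}_\blacktriangle$ uses $\neg,\wedge,\vee,\blacktriangle$ and $\mathcal{L}_\Box$ uses $\neg,\wedge,\vee,\Box$. A frame is $\langle W,R\rangle$, $W\neq\varnothing$, $R\subseteq W^2$; a model is $\langle W,R,v^+,v^-\rangle$ with independent $v^+,v^-:\mathsf{Var}\to 2^W$; a pointed model is a model with a state. $w\vDash^+p$ iff $w\in v^+(p)$; $w\vDash^-p$ iff $w\in v^-(p)$; $\neg$ swaps $\vDash^+$ and $\vDash^-$; $\wedge$: true iff both true, false iff some false; $\vee$: true iff some true, false iff both false. $w\vDash^+\Box\phi$ iff every $R$-successor $w'$ of $w$ has $w'\vDash^+\phi$; $w\vDash^-\Box\phi$ iff some $R$-successor $w'$ has $w'\vDash^-\phi$. $w_0\vDash^+\blacktriangle\phi$ iff for all $R$-successors $w_1,w_2$ of $w_0$, ($w_1\vDash^+\phi\Rightarrow w_2\vDash^+\phi$) and ($w_1\vDash^-\phi\Rightarrow w_2\vDash^-\phi$), and every $R$-successor $w_1$ has $w_1\vDash^+\phi$ or $w_1\vDash^-\phi$. $w_0\vDash^-\blacktriangle\phi$ iff there are successors $w_1,w_2$ of $w_0$ with ($w_1\vDash^+\phi$, $w_2\nvDash^+\phi$) or ($w_1\vDash^-\phi$, $w_2\nvDash^-\phi$)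 or ($w_1\vDash^+\phi$, $w_2\vDash^-\phi$). A formula $\phi$ of one language defines a formula $\chi$ of another in a class $\mathbb{K}$ of frames iff for every $\mathfrak{F}\in\mathbb{K}$ and every pointed model $\langle\mathfrak{M},w\rangle$ on $\mathfrak{F}$: $\mathfrak{M},w\vDash^+\phi$ iff $\mathfrak{M},w\vDash^+\chi$, and $\mathfrak{M},w\vDash^-\phi$ iff $\mathfrak{M},w\vDash^-\chi$. -}

module Defs where

open import Data.Nat using (ℕ)
open import Data.Unit using (⊤)
open import Data.Product using (Σ; ∃; _×_; _,_)
open import Data.Sum using (_⊎_)
open import Relation.Nullary using (¬_)
open import Function.Bundles using (_⇔_)

Var : Set
Var = ℕ

data Form□ : Set where
  var : Var → Form□
  ¬□  : Form□ → Form□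
  _∧□_ : Form□ → Form□ → Form□
  _∨□_ : Form□ → Form□ → Form□
  □   : Form□ → Form□

data Form▲ : Set where
  var : Var → Form▲
  ¬▲  : Form▲ → Form▲
  _∧▲_ : Form▲ → Form▲ → Form▲
  _∨▲_ : Form▲ → Form▲ → Form▲
  ▲   : Form▲ → Form▲

-- A frame: a carrier W with a relation R.  (Nonemptiness of W is
-- automatic for any frame carrying a pointed model.)
record Model (W : Set) (R : W → W → Set) : Set₁ where
  field
    v⁺ : Var → W → Set
    v⁻ : Var → W → Set
open Model public

-- Belnapian / paraconsistent satisfaction for L_□ : (true, false)
mutual
  ⊨⁺□ : {W : Set} {R : W → W → Set} → Model W R → W → Form□ → Set
  ⊨⁺□ M w (var p) = v⁺ M p w
  ⊨⁺□ M w (¬□ φ) = ⊨⁻□ M w φ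
  ⊨⁺□ M w (φ ∧□ ψ) = ⊨⁺□ M w φ × ⊨⁺□ M w ψ
  ⊨⁺□ M w (φ ∨□ ψ) = ⊨⁺□ M w φ ⊎ ⊨⁺□ M w ψ
  ⊨⁺□ {R = R} M w (□ φ) = ∀ w′ → R w w′ → ⊨⁺□ M w′ φ

  ⊨⁻□ : {W : Set} {R : W → W → Set} → Model W R → W → Form□ → Set
  ⊨⁻□ M w (var p) = v⁻ M p w
  ⊨⁻□ M w (¬□ φ) = ⊨⁺□ M w φ
  ⊨⁻□ M w (φ ∧□ ψ) = ⊨⁻□ M w φ ⊎ ⊨⁻□ M w ψ
  ⊨⁻□ M w (φ ∨□ ψ) = ⊨⁻□ M w φ × ⊨⁻□ M w ψ
  ⊨⁻□ {R = R} M w (□ φ) = Σ _ λ w′ → R w w′ × ⊨⁻□ M w′ φ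

mutual
  ⊨⁺▲ : {W : Set} {R : W → W → Set} → Model W R → W → Form▲ → Set
  ⊨⁺▲ M w (var p) = v⁺ M p w
  ⊨⁺▲ M w (¬▲ φ) = ⊨⁻▲ M w φ
  ⊨⁺▲ M w (φ ∧▲ ψ) = ⊨⁺▲ M w φ × ⊨⁺▲ M w ψ
  ⊨⁺▲ M w (φ ∨▲ ψ) = ⊨⁺▲ M w φ ⊎ ⊨⁺▲ M w ψ
  ⊨⁺▲ {R = R} M w (▲ φ) =
    (∀ w₁ w₂ → R w w₁ → R w w₂ →
        (⊨⁺▲ M w₁ φ → ⊨⁺▲ M w₂ φ) × (⊨⁻▲ M w₁ φ → ⊨⁻▲ M w₂ φ))
    × (∀ w₁ → R w w₁ → ⊨⁺▲ M w₁ φ ⊎ ⊨⁻▲ M w₁ φ)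

  ⊨⁻▲ : {W : Set} {R : W → W → Set} → Model W R → W → Form▲ → Set
  ⊨⁻▲ M w (var p) = v⁻ M p w
  ⊨⁻▲ M w (¬▲ φ) = ⊨⁺▲ M w φ
  ⊨⁻▲ M w (φ ∧▲ ψ) = ⊨⁻▲ M w φ ⊎ ⊨⁻▲ M w ψ
  ⊨⁻▲ M w (φ ∨▲ ψ) = ⊨⁻▲ M w φ × ⊨⁻▲ M w ψ
  ⊨⁻▲ {R = R} M w (▲ φ) =
    Σ _ λ w₁ → Σ _ λ w₂ → R w w₁ × R w w₂ ×
      ((⊨⁺▲ M w₁ φ × ¬ ⊨⁺▲ M w₂ φ)
       ⊎ (⊨⁻▲ M w₁ φ × ¬ ⊨⁻▲ M w₂ φ)
       ⊎ (⊨⁺▲ M w₁ φ × ⊨⁻▲ M w₂ φ))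

FrameClass : Set₁
FrameClass = (W : Set) → (W → W → Set) → Set

AllFrames Reflexive Transitive Symmetric Euclidean : FrameClass
AllFrames W R = ⊤
Reflexive W R = ∀ x → R x x
Transitive W R = ∀ x y z → R x y → R y z → R x z
Symmetric W R = ∀ x y → R x y → R y x
Euclidean W R = ∀ x y z → R x y → R x z → R y z

Defines : FrameClass → Form□ → Form▲ → Set₁
Defines K φ χ =
  ∀ (W : Set) (R : W → W → Set) → K W R →
  ∀ (M : Model W R) (w : W) →
    (⊨⁺□ M w φ ⇔ ⊨⁺▲ M w χ) × (⊨⁻□ M w φ ⇔ ⊨⁻▲ M w χ)

{-# OPTIONS --safe #-}
module Submission where

open import Defs
open import Data.Bool using (Bool; true; false)
open import Data.Empty using (⊥)
open import Data.Product using (Σ; _×_; _,_; proj₁; proj₂)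
open import Data.Sum using (inj₁; inj₂)
open import Data.Unit using (⊤; tt)
open import Function.Bundles using (Equivalence)
open import Relation.Binary.PropositionalEquality using (_≡_; refl)
open import Relation.Nullary using (¬_)
open import Relation.Unary using (_⊆_)

-- Truth and falsity of an L_□ formula are monotone in the valuation: enlarging
-- the extensions v⁺ and v⁻ of the variables preserves both.  ▲p is not
-- monotone: on the two-point universal frame with p true everywhere and false
-- nowhere, ▲p holds, but making p also false at one point destroys it.  The
-- universal frame is reflexive, transitive, symmetric and Euclidean, so no
-- L_□ formula defines ▲p on any of the five classes.

record _⊑_ {W : Set} {R : W → W → Set} (M N : Model W R) : Set where
  field
    v⁺-⊆ : ∀ q → v⁺ M q ⊆ v⁺ N q
    v⁻-⊆ : ∀ q → v⁻ M q ⊆ v⁻ N q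
open _⊑_

module _ {W : Set} {R : W → W → Set} {M N : Model W R} (M⊑N : M ⊑ N) where
  mutual
    ⊨⁺□-mono : ∀ w φ → ⊨⁺□ M w φ → ⊨⁺□ N w φ
    ⊨⁺□-mono w (var q)  h        = v⁺-⊆ M⊑N q h
    ⊨⁺□-mono w (¬□ φ)   h        = ⊨⁻□-mono w φ h
    ⊨⁺□-mono w (φ ∧□ ψ) (a , b)  = ⊨⁺□-mono w φ a , ⊨⁺□-mono w ψ b
    ⊨⁺□-mono w (φ ∨□ ψ) (inj₁ a) = inj₁ (⊨⁺□-mono w φ a)
    ⊨⁺□-mono w (φ ∨□ ψ) (inj₂ b) = inj₂ (⊨⁺□-mono w ψ b)
    ⊨⁺□-mono w (□ φ)    h        = λ w′ r → ⊨⁺□-mono w′ φ (h w′ r)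

    ⊨⁻□-mono : ∀ w φ → ⊨⁻□ M w φ → ⊨⁻□ N w φ
    ⊨⁻□-mono w (var q)  h            = v⁻-⊆ M⊑N q h
    ⊨⁻□-mono w (¬□ φ)   h            = ⊨⁺□-mono w φ h
    ⊨⁻□-mono w (φ ∧□ ψ) (inj₁ a)     = inj₁ (⊨⁻□-mono w φ a)
    ⊨⁻□-mono w (φ ∧□ ψ) (inj₂ b)     = inj₂ (⊨⁻□-mono w ψ b)
    ⊨⁻□-mono w (φ ∨□ ψ) (a , b)      = ⊨⁻□-mono w φ a , ⊨⁻□-mono w ψ b
    ⊨⁻□-mono w (□ φ)    (w′ , r , h) = w′ , r , ⊨⁻□-mono w′ φ h

Defines⇒⊨⁺▲-mono : ∀ {K φ χ W R} → Defines K φ χ → K W R →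
                   {M N : Model W R} → M ⊑ N →
                   ∀ w → ⊨⁺▲ M w χ → ⊨⁺▲ N w χ
Defines⇒⊨⁺▲-mono {φ = φ} {W = W} {R} def k {M} {N} M⊑N w χ-true =
  Equivalence.to (proj₁ (def W R k N w))
    (⊨⁺□-mono M⊑N w φ (Equivalence.from (proj₁ (def W R k M w)) χ-true))

Universal : (W : Set) → W → W → Set
Universal _ _ _ = ⊤

everywhere-true : Model Bool (Universal Bool)
everywhere-true = record { v⁺ = λ _ _ → ⊤ ; v⁻ = λ _ _ → ⊥ }

glut-at-true : Model Bool (Universal Bool)
glut-at-true = record { v⁺ = λ _ _ → ⊤ ; v⁻ = λ _ w → w ≡ true }

everywhere-true⊑glut-at-true : everywhere-true ⊑ glut-at-true
everywhere-true⊑glut-at-true = record { v⁺-⊆ = λ _ t → t ; v⁻-⊆ = λ _ () }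

▲var-everywhere-true : ∀ p w → ⊨⁺▲ everywhere-true w (▲ (var p))
▲var-everywhere-true p w = (λ _ _ _ _ → (λ _ → tt) , λ ()) , λ _ _ → inj₁ tt

¬▲var-glut-at-true : ∀ p w → ¬ ⊨⁺▲ glut-at-true w (▲ (var p))
¬▲var-glut-at-true p w (constant , _) with proj₂ (constant true false tt tt) refl
... | ()

▲var-undefinable : ∀ {K} → K Bool (Universal Bool) →
                   ∀ p → ¬ Σ Form□ (λ φ → Defines K φ (▲ (var p)))
▲var-undefinable {K} k p (φ , def) =
  ¬▲var-glut-at-true p true
    (Defines⇒⊨⁺▲-mono {K} {φ} {▲ (var p)} def k everywhere-true⊑glut-at-true true
      (▲var-everywhere-true p true))

theorem4 : (p : Var) →
    (¬ Σ Form□ (λ φ → Defines AllFrames φ (▲ (var p))))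
    × (¬ Σ Form□ (λ φ → Defines Reflexive φ (▲ (var p))))
    × (¬ Σ Form□ (λ φ → Defines Transitive φ (▲ (var p))))
    × (¬ Σ Form□ (λ φ → Defines Symmetric φ (▲ (var p))))
    × (¬ Σ Form□ (λ φ → Defines Euclidean φ (▲ (var p))))
theorem4 p = ▲var-undefinable {AllFrames}  tt                  p
           , ▲var-undefinable {Reflexive}  (λ _ → tt)          p
           , ▲var-undefinable {Transitive} (λ _ _ _ _ _ → tt)  p
           , ▲var-undefinable {Symmetric}  (λ _ _ _ → tt)      p
           , ▲var-undefinable {Euclidean}  (λ _ _ _ _ _ → tt)  p
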